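{- Let $k\ge2$ and $n$ be positive integers and let $\mathcal{F}\subset\binom{[n]}{k}$ be a nonempty regular intersecting family. Then $$|\mathcal{F}|\ge 1+\frac{k(n-k)}{k^2-n},$$ with equality only if $\sum_{i=1}^{k-2}a_i=0$, where $a_i=\frac{1}{|\mathcal{F}|}\,\#\{(F,F')\in\mathcal{F}\times\mathcal{F}:|F\cap F'|=k-i\}$.
   Context: $[n]=\{1,\dots,n\}$, $\binom{[n]}{k}$ is the set of $k$-subsets of $[n]$. A family is intersecting if any two of its members intersect; it is regular if every element of $[n]$ lies in the same number of members of the family. The vector $(a_0,\dots,a_k)$ defined in the claim is the inner distribution of $\mathcal{F}$. -}

module Defs where

open import Data.Nat using (ℕ; suc; _∸_; _≟_)
open import Data.Fin using (Fin)
open import Data.Fin.Subset using (Subset; _∩_; ∣_∣; _∈_; Nonempty)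
open import Data.Fin.Subset.Properties using (_∈?_)
open import Data.List using (List; length; filter; cartesianProduct; foldr; applyUpTo)
open import Data.Integer using (+_)
open import Data.Rational.Unnormalised using (ℚᵘ; mkℚᵘ; _+_; 0ℚᵘ)
open import Data.List.Membership.Propositional renaming (_∈_ to _∈ₗ_)
open import Data.List.Relation.Unary.Unique.Propositional using (Unique)
open import Data.Product using (_×_; _,_; ∃)
open import Relation.Binary.PropositionalEquality using (_≡_)

Family : ℕ → Set
Family n = List (Subset n)

Uniform : ∀ {n} → ℕ → Family n → Set
Uniform k F = ∀ A → A ∈ₗ F → ∣ A ∣ ≡ k

Intersecting : ∀ {n} → Family n → Set
Intersecting F = ∀ A B → A ∈ₗ F → B ∈ₗ F → Nonempty (A ∩ B)

degree : ∀ {n} → Family n → Fin n → ℕ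
degree F x = length (filter (x ∈?_) F)

Regular : ∀ {n} → Family n → Set
Regular {n} F = ∃ λ d → ∀ (x : Fin n) → degree F x ≡ d

pairCount : ∀ {n} → Family n → ℕ → ℕ
pairCount F j = length (filter (λ p → ∣ proj₁' p ∩ proj₂' p ∣ ≟ j) (cartesianProduct F F))
  where
  proj₁' : ∀ {A : Set} → A × A → A
  proj₁' (a , _) = a
  proj₂' : ∀ {A : Set} → A × A → A
  proj₂' (_ , b) = b

-- inner distribution a_i = (1/|F|) #{(A,B) ∈ F×F : |A ∩ B| = k - i}, as an
-- unnormalised rational. mkℚᵘ p m denotes p / (suc m), so the denominator is
-- |F| whenever F is nonempty (which the theorem assumes).
innerDist : ∀ {n} → ℕ → Family n → ℕ → ℚᵘ
innerDist k F i = mkℚᵘ (+ pairCount F (k ∸ i)) (length F ∸ 1)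

innerSum : ∀ {n} → ℕ → Family n → ℚᵘ
innerSum k F = foldr _+_ 0ℚᵘ (applyUpTo (λ j → innerDist k F (suc j)) (k ∸ 2))

-- Fix a member A. Counting incidences, Σ_{B ∈ F} |A ∩ B| = k·d for the common degree d,
-- and m·k = n·d with m = |F|. Since F is intersecting, each of the m − 1 other members
-- contributes at least 1, so k·d + 1 − k − m =: s ≥ 0. Eliminating d via m·k = n·d gives
-- (m − 1)(k² − n) = k(n − k) + n·s, hence the bound (which also rules out n ≥ k²); in case
-- of equality s = 0, so every other member meets A in exactly one element and no
-- intersection size lies in [2, k − 1].
module Submission where

open import Defs
open import Data.Nat using (ℕ; _≤_; _<_; _*_)
open import Data.Integer using (ℤ; +_; _-_) renaming (_*_ to _*ℤ_; _≤_ to _≤ℤ_)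
open import Data.Rational.Unnormalised using (_≃_; 0ℚᵘ)
open import Data.List using (length; [])
open import Data.List.Relation.Unary.Unique.Propositional using (Unique)
open import Data.Product using (_×_)
open import Relation.Binary.PropositionalEquality using (_≡_; _≢_)

open import Data.Nat using (zero; suc; _+_; _∸_; z≤n; s≤s; s≤s⁻¹; NonZero; >-nonZero)
import Data.Nat.Properties as ℕ
open import Data.Integer using (_⊖_) renaming (_+_ to _+ℤ_)
import Data.Integer.Properties as ℤ
open import Data.Integer.Tactic.RingSolver using (solve-∀)
open import Algebra.Properties.AbelianGroup ℤ.+-0-abelianGroup using (identityʳ-unique)
import Algebra.Properties.CommutativeSemigroup as CommutativeSemigroup
open import Data.Rational.Unnormalised using (ℚᵘ; mkℚᵘ; *≡*) renaming (_+_ to _+ℚ_)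
import Data.Rational.Unnormalised.Properties as ℚ
open import Data.Vec using ([]; _∷_; tail)
open import Data.Fin using (Fin) renaming (zero to fzero; suc to fsuc)
open import Data.Fin.Subset using (Subset; inside; outside; ⊤; _∩_; ∣_∣; _∈_)
open import Data.Fin.Subset.Properties using (_∈?_; ∣⊤∣≡n; ∩-idem; ∩-identityˡ; x∈p⇒∣p-x∣<∣p∣)
open import Data.List using (List; _∷_; map; foldr; cartesianProduct)
open import Data.List.Properties using (length-removeAt′; filter-none)
open import Data.List.Membership.Propositional using (_─_) renaming (_∈_ to _∈ₗ_)
open import Data.List.Membership.Propositional.Properties using (∈-cartesianProduct⁻)
open import Data.List.Relation.Unary.Any using (here; there; index)
open import Data.List.Relation.Unary.All as All using (All; []; _∷_)
open import Data.List.Relation.Unary.All.Properties using (applyUpTo⁺₁)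
open import Data.Product using (_,_)
open import Data.Empty using (⊥-elim)
open import Function using (_∘_)
open import Relation.Nullary using (¬_; yes; no)
open import Relation.Binary.PropositionalEquality using (refl; sym; trans; cong; cong₂; subst; module ≡-Reasoning)

open CommutativeSemigroup ℕ.+-commutativeSemigroup using () renaming (x∙yz≈y∙xz to x+[y+z]≡y+[x+z])
open CommutativeSemigroup ℕ.*-commutativeSemigroup using () renaming (x∙yz≈y∙xz to x*[y*z]≡y*[x*z])

∑ : {A : Set} → List A → (A → ℕ) → ℕ
∑ []       f = 0
∑ (x ∷ xs) f = f x + ∑ xs f

syntax ∑ xs (λ x → e) = ∑[ x ∈ xs ] e

module _ {A : Set} where

  ∑-cong : ∀ {xs : List A} {f g : A → ℕ} → (∀ {x} → x ∈ₗ xs → f x ≡ g x) → ∑ xs f ≡ ∑ xs g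
  ∑-cong {[]}     f≗g = refl
  ∑-cong {x ∷ xs} f≗g = cong₂ _+_ (f≗g (here refl)) (∑-cong (f≗g ∘ there))

  ∑-const : ∀ (xs : List A) c → ∑[ _ ∈ xs ] c ≡ length xs * c
  ∑-const []       c = refl
  ∑-const (x ∷ xs) c = cong (_+_ c) (∑-const xs c)

  ∑-map : ∀ {B : Set} (h : A → B) (xs : List A) (f : B → ℕ) → ∑ (map h xs) f ≡ ∑[ x ∈ xs ] f (h x)
  ∑-map h []       f = refl
  ∑-map h (x ∷ xs) f = cong (_+_ (f (h x))) (∑-map h xs f)

  ∑-─ : ∀ {xs : List A} {x} (f : A → ℕ) (x∈xs : x ∈ₗ xs) → ∑ xs f ≡ f x + ∑ (xs ─ x∈xs) f
  ∑-─ f (here refl) = refl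
  ∑-─ {y ∷ xs} {x} f (there x∈xs) =
    trans (cong (_+_ (f y)) (∑-─ f x∈xs)) (x+[y+z]≡y+[x+z] (f y) (f x) (∑ (xs ─ x∈xs) f))

  ∈-─ : ∀ {xs : List A} {x y} (x∈xs : x ∈ₗ xs) → y ∈ₗ xs → y ≢ x → y ∈ₗ xs ─ x∈xs
  ∈-─ (here refl)  (here refl)  y≢x = ⊥-elim (y≢x refl)
  ∈-─ (here refl)  (there y∈xs) _   = y∈xs
  ∈-─ (there x∈xs) (here refl)  _   = here refl
  ∈-─ (there x∈xs) (there y∈xs) y≢x = there (∈-─ x∈xs y∈xs y≢x)

  ∈-─⁻ : ∀ {xs : List A} {x y} (x∈xs : x ∈ₗ xs) → y ∈ₗ xs ─ x∈xs → y ∈ₗ xs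
  ∈-─⁻ (here refl)  y∈xs         = there y∈xs
  ∈-─⁻ (there x∈xs) (here refl)  = here refl
  ∈-─⁻ (there x∈xs) (there y∈xs) = there (∈-─⁻ x∈xs y∈xs)

  length≤∑ : ∀ {xs : List A} (f : A → ℕ) → (∀ {x} → x ∈ₗ xs → 1 ≤ f x) → length xs ≤ ∑ xs f
  length≤∑ {[]}     f positive = z≤n
  length≤∑ {x ∷ xs} f positive = ℕ.+-mono-≤ (positive (here refl)) (length≤∑ f (positive ∘ there))

  ∑≤length⇒≤1 : ∀ {xs : List A} (f : A → ℕ) → (∀ {x} → x ∈ₗ xs → 1 ≤ f x) →
                ∑ xs f ≤ length xs → ∀ {x} → x ∈ₗ xs → f x ≤ 1
  ∑≤length⇒≤1 {x ∷ xs} f positive ∑≤length (here refl) =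
    ℕ.+-cancelʳ-≤ (∑ xs f) (f x) 1 (ℕ.≤-trans ∑≤length (s≤s (length≤∑ f (positive ∘ there))))
  ∑≤length⇒≤1 {x ∷ xs} f positive ∑≤length (there y∈xs) =
    ∑≤length⇒≤1 f (positive ∘ there)
      (s≤s⁻¹ (ℕ.≤-trans (ℕ.+-monoˡ-≤ (∑ xs f) (positive (here refl))) ∑≤length)) y∈xs

x∈p⇒0<∣p∣ : ∀ {n} {x : Fin n} {p : Subset n} → x ∈ p → 0 < ∣ p ∣
x∈p⇒0<∣p∣ x∈p = ℕ.≤-<-trans z≤n (x∈p⇒∣p-x∣<∣p∣ x∈p)

degree-map-tail : ∀ {n} (F : Family (suc n)) x → degree (map tail F) x ≡ degree F (fsuc x)
degree-map-tail []            x = refl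
degree-map-tail ((_ ∷ B) ∷ F) x with x ∈? B
... | yes _ = cong suc (degree-map-tail F x)
... | no  _ = degree-map-tail F x

regular-map-tail : ∀ {n d} (F : Family (suc n)) → (∀ x → degree F x ≡ d) → ∀ x → degree (map tail F) x ≡ d
regular-map-tail F regular x = trans (degree-map-tail F x) (regular (fsuc x))

∑∣inside∷A∩∣ : ∀ {n} (A : Subset n) (F : Family (suc n)) →
               ∑[ B ∈ F ] ∣ (inside ∷ A) ∩ B ∣ ≡ degree F fzero + ∑[ B ∈ F ] ∣ A ∩ tail B ∣
∑∣inside∷A∩∣ A []                  = refl
∑∣inside∷A∩∣ A ((inside ∷ B) ∷ F)  =
  cong suc (trans (cong (_+_ ∣ A ∩ B ∣) (∑∣inside∷A∩∣ A F))
                  (x+[y+z]≡y+[x+z] ∣ A ∩ B ∣ (degree F fzero) (∑[ C ∈ F ] ∣ A ∩ tail C ∣)))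
∑∣inside∷A∩∣ A ((outside ∷ B) ∷ F) =
  trans (cong (_+_ ∣ A ∩ B ∣) (∑∣inside∷A∩∣ A F))
        (x+[y+z]≡y+[x+z] ∣ A ∩ B ∣ (degree F fzero) (∑[ C ∈ F ] ∣ A ∩ tail C ∣))

∑∣∩∣≡∣∣*degree : ∀ {n d} (A : Subset n) (F : Family n) → (∀ x → degree F x ≡ d) →
                 ∑[ B ∈ F ] ∣ A ∩ B ∣ ≡ ∣ A ∣ * d
∑∣∩∣≡∣∣*degree [] F _ =
  trans (∑-cong {xs = F} {g = λ _ → 0} λ { {[]} _ → refl }) (trans (∑-const F 0) (ℕ.*-zeroʳ (length F)))
∑∣∩∣≡∣∣*degree {d = d} (outside ∷ A) F regular = begin
  ∑[ B ∈ F ] ∣ (outside ∷ A) ∩ B ∣ ≡⟨ ∑-cong {xs = F} (λ { {_ ∷ _} _ → refl }) ⟩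
  ∑[ B ∈ F ] ∣ A ∩ tail B ∣        ≡⟨ ∑-map tail F (λ B → ∣ A ∩ B ∣) ⟨
  ∑[ B ∈ map tail F ] ∣ A ∩ B ∣    ≡⟨ ∑∣∩∣≡∣∣*degree A (map tail F) (regular-map-tail F regular) ⟩
  ∣ A ∣ * d                        ∎
  where open ≡-Reasoning
∑∣∩∣≡∣∣*degree {d = d} (inside ∷ A) F regular = begin
  ∑[ B ∈ F ] ∣ (inside ∷ A) ∩ B ∣             ≡⟨ ∑∣inside∷A∩∣ A F ⟩
  degree F fzero + ∑[ B ∈ F ] ∣ A ∩ tail B ∣  ≡⟨ cong (_+_ (degree F fzero)) (∑-map tail F (λ B → ∣ A ∩ B ∣)) ⟨
  degree F fzero + ∑[ B ∈ map tail F ] ∣ A ∩ B ∣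
    ≡⟨ cong₂ _+_ (regular fzero) (∑∣∩∣≡∣∣*degree A (map tail F) (regular-map-tail F regular)) ⟩
  d + ∣ A ∣ * d                               ∎
  where open ≡-Reasoning

module _ {n k d} {F : Family n} (uniform : Uniform k F) (regular : ∀ x → degree F x ≡ d) where

  size*k≡n*degree : length F * k ≡ n * d
  size*k≡n*degree = begin
    length F * k         ≡⟨ ∑-const F k ⟨
    ∑[ _ ∈ F ] k         ≡⟨ ∑-cong (λ {B} B∈F → trans (sym (uniform B B∈F)) (cong ∣_∣ (sym (∩-identityˡ B)))) ⟩
    ∑[ B ∈ F ] ∣ ⊤ ∩ B ∣ ≡⟨ ∑∣∩∣≡∣∣*degree (⊤ {n}) F regular ⟩
    ∣ ⊤ {n} ∣ * d        ≡⟨ cong (_* d) (∣⊤∣≡n n) ⟩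
    n * d                ∎
    where open ≡-Reasoning

  ∣A∩A∣≡k : ∀ {A} → A ∈ₗ F → ∣ A ∩ A ∣ ≡ k
  ∣A∩A∣≡k {A} A∈F = trans (cong ∣_∣ (∩-idem A)) (uniform A A∈F)

  k+∑others≡k*degree : ∀ {A} (A∈F : A ∈ₗ F) → k + ∑[ B ∈ F ─ A∈F ] ∣ A ∩ B ∣ ≡ k * d
  k+∑others≡k*degree {A} A∈F = begin
    k + ∑[ B ∈ F ─ A∈F ] ∣ A ∩ B ∣                ≡⟨ cong (_+ _) (∣A∩A∣≡k A∈F) ⟨
    ∣ A ∩ A ∣ + ∑[ B ∈ F ─ A∈F ] ∣ A ∩ B ∣        ≡⟨ ∑-─ (λ B → ∣ A ∩ B ∣) A∈F ⟨
    ∑[ B ∈ F ] ∣ A ∩ B ∣                          ≡⟨ ∑∣∩∣≡∣∣*degree A F regular ⟩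
    ∣ A ∣ * d                                     ≡⟨ cong (_* d) (uniform A A∈F) ⟩
    k * d                                         ∎
    where open ≡-Reasoning

  module _ (intersecting : Intersecting F) where

    private
      positive-─ : ∀ {A} (A∈F : A ∈ₗ F) {B} → B ∈ₗ F ─ A∈F → 0 < ∣ A ∩ B ∣
      positive-─ {A} A∈F {B} B∈F─A with intersecting A B A∈F (∈-─⁻ A∈F B∈F─A)
      ... | _ , x∈A∩B = x∈p⇒0<∣p∣ x∈A∩B

    k+size≤1+k*degree : ∀ {A} → A ∈ₗ F → k + length F ≤ suc (k * d)
    k+size≤1+k*degree {A} A∈F = begin
      k + length F                        ≡⟨ cong (_+_ k) (length-removeAt′ F (index A∈F)) ⟩
      k + suc (length (F ─ A∈F))          ≡⟨ ℕ.+-suc k _ ⟩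
      suc (k + length (F ─ A∈F))          ≤⟨ s≤s (ℕ.+-monoʳ-≤ k (length≤∑ (λ B → ∣ A ∩ B ∣) (positive-─ A∈F))) ⟩
      suc (k + ∑[ B ∈ F ─ A∈F ] ∣ A ∩ B ∣) ≡⟨ cong suc (k+∑others≡k*degree A∈F) ⟩
      suc (k * d)                         ∎
      where open ℕ.≤-Reasoning

    1+k*degree≤k+size⇒∣∩∣≤1 : suc (k * d) ≤ k + length F →
                              ∀ {A B} → A ∈ₗ F → B ∈ₗ F → B ≢ A → ∣ A ∩ B ∣ ≤ 1
    1+k*degree≤k+size⇒∣∩∣≤1 tight {A} A∈F B∈F B≢A =
      ∑≤length⇒≤1 (λ B → ∣ A ∩ B ∣) (positive-─ A∈F) ∑others≤length (∈-─ A∈F B∈F B≢A)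
      where
      ∑others≤length : ∑[ B ∈ F ─ A∈F ] ∣ A ∩ B ∣ ≤ length (F ─ A∈F)
      ∑others≤length = ℕ.+-cancelˡ-≤ k _ _ (s≤s⁻¹ (begin
        suc (k + ∑[ B ∈ F ─ A∈F ] ∣ A ∩ B ∣) ≡⟨ cong suc (k+∑others≡k*degree A∈F) ⟩
        suc (k * d)                         ≤⟨ tight ⟩
        k + length F                        ≡⟨ cong (_+_ k) (length-removeAt′ F (index A∈F)) ⟩
        k + suc (length (F ─ A∈F))          ≡⟨ ℕ.+-suc k _ ⟩
        suc (k + length (F ─ A∈F))          ∎))
        where open ℕ.≤-Reasoning

    1+k*degree≤k+size⇒∣∩∣≢ : suc (k * d) ≤ k + length F → ∀ {j} → 2 ≤ j → j < k →
                            ∀ {A B} → A ∈ₗ F → B ∈ₗ F → ∣ A ∩ B ∣ ≢ j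
    1+k*degree≤k+size⇒∣∩∣≢ tight 2≤j j<k {A} {B} A∈F B∈F ∣A∩B∣≡j =
      ℕ.<⇒≱ 2≤j (subst (_≤ 1) ∣A∩B∣≡j (1+k*degree≤k+size⇒∣∩∣≤1 tight A∈F B∈F B≢A))
      where
      B≢A : B ≢ A
      B≢A refl = ℕ.<⇒≢ j<k (trans (sym ∣A∩B∣≡j) (∣A∩A∣≡k A∈F))

defect-identity : ∀ (K N M D : ℤ) → M *ℤ K ≡ N *ℤ D →
  (M - + 1) *ℤ (K *ℤ K - N) ≡ K *ℤ (N - K) +ℤ N *ℤ ((+ 1 +ℤ K *ℤ D) - (K +ℤ M))
defect-identity K N M D MK≡ND = begin
  (M - + 1) *ℤ (K *ℤ K - N)       ≡⟨ expand K N M D ⟩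
  rhs +ℤ K *ℤ (M *ℤ K - N *ℤ D)   ≡⟨ cong (λ z → rhs +ℤ K *ℤ (z - N *ℤ D)) MK≡ND ⟩
  rhs +ℤ K *ℤ (N *ℤ D - N *ℤ D)   ≡⟨ cong (λ z → rhs +ℤ K *ℤ z) (ℤ.+-inverseʳ (N *ℤ D)) ⟩
  rhs +ℤ K *ℤ + 0                 ≡⟨ cong (rhs +ℤ_) (ℤ.*-zeroʳ K) ⟩
  rhs +ℤ + 0                      ≡⟨ ℤ.+-identityʳ rhs ⟩
  rhs                             ∎
  where
  open ≡-Reasoning
  rhs : ℤ
  rhs = K *ℤ (N - K) +ℤ N *ℤ ((+ 1 +ℤ K *ℤ D) - (K +ℤ M))
  expand : ∀ K N M D → (M - + 1) *ℤ (K *ℤ K - N) ≡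
           K *ℤ (N - K) +ℤ N *ℤ ((+ 1 +ℤ K *ℤ D) - (K +ℤ M)) +ℤ K *ℤ (M *ℤ K - N *ℤ D)
  expand = solve-∀

module SizeBound {k n m d : ℕ} (m*k≡n*d : m * k ≡ n * d) (k+m≤1+k*d : k + m ≤ suc (k * d)) where

  private
    slack : ℕ
    slack = suc (k * d) ∸ (k + m)

    +slack : + slack ≡ (+ 1 +ℤ + k *ℤ + d) - (+ k +ℤ + m)
    +slack = begin
      + (suc (k * d) ∸ (k + m))          ≡⟨ ℤ.⊖-≥ k+m≤1+k*d ⟨
      suc (k * d) ⊖ (k + m)              ≡⟨ ℤ.m-n≡m⊖n (suc (k * d)) (k + m) ⟨
      + suc (k * d) - + (k + m)
        ≡⟨ cong₂ _-_ (trans (ℤ.pos-+ 1 (k * d)) (cong (+ 1 +ℤ_) (ℤ.pos-* k d))) (ℤ.pos-+ k m) ⟩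
      (+ 1 +ℤ + k *ℤ + d) - (+ k +ℤ + m) ∎
      where open ≡-Reasoning

    slack-identity : (+ m - + 1) *ℤ (+ (k * k) - + n) ≡ + k *ℤ (+ n - + k) +ℤ + (n * slack)
    slack-identity = begin
      (+ m - + 1) *ℤ (+ (k * k) - + n)
        ≡⟨ cong (λ z → (+ m - + 1) *ℤ (z - + n)) (ℤ.pos-* k k) ⟩
      (+ m - + 1) *ℤ (+ k *ℤ + k - + n)
        ≡⟨ defect-identity (+ k) (+ n) (+ m) (+ d) +m*+k≡+n*+d ⟩
      + k *ℤ (+ n - + k) +ℤ + n *ℤ ((+ 1 +ℤ + k *ℤ + d) - (+ k +ℤ + m))
        ≡⟨ cong (λ s → + k *ℤ (+ n - + k) +ℤ + n *ℤ s) +slack ⟨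
      + k *ℤ (+ n - + k) +ℤ + n *ℤ + slack
        ≡⟨ cong (+ k *ℤ (+ n - + k) +ℤ_) (ℤ.pos-* n slack) ⟨
      + k *ℤ (+ n - + k) +ℤ + (n * slack)
        ∎
      where
      open ≡-Reasoning
      +m*+k≡+n*+d : + m *ℤ + k ≡ + n *ℤ + d
      +m*+k≡+n*+d = trans (sym (ℤ.pos-* m k)) (trans (cong +_ m*k≡n*d) (ℤ.pos-* n d))

  k[n-k]≤[m-1][k²-n] : + k *ℤ (+ n - + k) ≤ℤ (+ m - + 1) *ℤ (+ (k * k) - + n)
  k[n-k]≤[m-1][k²-n] = ℤ.≤-trans (ℤ.i≤i+j _ (+ (n * slack))) (ℤ.≤-reflexive (sym slack-identity))

  k[n-k]≡[m-1][k²-n]⇒1+k*d≤k+m : 0 < n →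
    (+ m - + 1) *ℤ (+ (k * k) - + n) ≡ + k *ℤ (+ n - + k) → suc (k * d) ≤ k + m
  k[n-k]≡[m-1][k²-n]⇒1+k*d≤k+m 0<n equal = ℕ.m∸n≡0⇒m≤n slack≡0
    where
    instance
      _ : NonZero n
      _ = >-nonZero 0<n
    n*slack≡0 : n * slack ≡ 0
    n*slack≡0 = ℤ.+-injective (identityʳ-unique _ _ (trans (sym slack-identity) equal))
    slack≡0 : slack ≡ 0
    slack≡0 = ℕ.m*n≡0⇒m≡0 slack n (trans (ℕ.*-comm slack n) n*slack≡0)

  n<k*k : 2 ≤ k → 0 < n → n < k * k
  n<k*k 2≤k 0<n = ℕ.≰⇒> k*k≰n
    where
    instance
      _ : NonZero n
      _ = >-nonZero 0<n
    k*k≰n : ¬ (k * k ≤ n)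
    k*k≰n k*k≤n = ℕ.<⇒≱ 2≤k (ℕ.*-cancelˡ-≤ n (subst (n * k ≤_) (sym (ℕ.*-identityʳ n)) n*k≤n))
      where
      open ℕ.≤-Reasoning
      n*k≤n : n * k ≤ n
      n*k≤n = ℕ.+-cancelʳ-≤ (n * m) (n * k) n (begin
        n * k + n * m     ≡⟨ ℕ.*-distribˡ-+ n k m ⟨
        n * (k + m)       ≤⟨ ℕ.*-monoʳ-≤ n k+m≤1+k*d ⟩
        n * suc (k * d)   ≡⟨ ℕ.*-suc n (k * d) ⟩
        n + n * (k * d)   ≡⟨ cong (_+_ n) (x*[y*z]≡y*[x*z] n k d) ⟩
        n + k * (n * d)   ≡⟨ cong (λ z → n + k * z) m*k≡n*d ⟨
        n + k * (m * k)   ≡⟨ cong (_+_ n) (x*[y*z]≡y*[x*z] k m k) ⟩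
        n + m * (k * k)   ≤⟨ ℕ.+-monoʳ-≤ n (ℕ.*-monoʳ-≤ m k*k≤n) ⟩
        n + m * n         ≡⟨ cong (_+_ n) (ℕ.*-comm m n) ⟩
        n + n * m         ∎)

pairCount≡0 : ∀ {n} (F : Family n) j →
              (∀ {A B} → A ∈ₗ F → B ∈ₗ F → ∣ A ∩ B ∣ ≢ j) → pairCount F j ≡ 0
pairCount≡0 F j never = cong length (filter-none _ {cartesianProduct F F} (All.tabulate λ AB∈F×F →
  let A∈F , B∈F = ∈-cartesianProduct⁻ F F AB∈F×F in never A∈F B∈F))

foldr-+-≃0 : ∀ {qs : List ℚᵘ} → All (_≃ 0ℚᵘ) qs → foldr _+ℚ_ 0ℚᵘ qs ≃ 0ℚᵘ
foldr-+-≃0 []           = ℚ.≃-refl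
foldr-+-≃0 (q≃0 ∷ qs≃0) = ℚ.≃-trans (ℚ.+-cong q≃0 (foldr-+-≃0 qs≃0)) (ℚ.+-identityˡ 0ℚᵘ)

innerSum≃0 : ∀ {n} k (F : Family n) →
             (∀ j → 2 ≤ j → j < k → pairCount F j ≡ 0) → innerSum k F ≃ 0ℚᵘ
innerSum≃0 zero          F _    = ℚ.≃-refl
innerSum≃0 (suc zero)    F _    = ℚ.≃-refl
innerSum≃0 (suc (suc k)) F none = foldr-+-≃0 (applyUpTo⁺₁ _ k λ {i} i<k →
  subst (λ c → mkℚᵘ (+ c) (length F ∸ 1) ≃ 0ℚᵘ)
        (sym (none (suc k ∸ i) (2≤1+k∸i i<k) (s≤s (ℕ.m∸n≤m (suc k) i))))
        (*≡* refl))
  where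
  2≤1+k∸i : ∀ {i} → i < k → 2 ≤ suc k ∸ i
  2≤1+k∸i {i} i<k = subst (2 ≤_) (sym (ℕ.+-∸-assoc 1 (ℕ.<⇒≤ i<k))) (s≤s (ℕ.m<n⇒0<n∸m i<k))

lemma23 : (n k : ℕ) → 2 ≤ k → 1 ≤ n → (F : Family n) →
    Unique F → Uniform k F → F ≢ [] → Regular F → Intersecting F →
    (n < k * k)
    × ((+ k) *ℤ (+ n - + k) ≤ℤ (+ length F - + 1) *ℤ (+ (k * k) - + n))
    × ((+ length F - + 1) *ℤ (+ (k * k) - + n) ≡ (+ k) *ℤ (+ n - + k) → innerSum k F ≃ 0ℚᵘ)
lemma23 n k 2≤k 0<n []        _ _       F≢[] _             _            = ⊥-elim (F≢[] refl)
lemma23 n k 2≤k 0<n F@(_ ∷ _) _ uniform _    (d , regular) intersecting =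
  n<k*k 2≤k 0<n , k[n-k]≤[m-1][k²-n] , λ equal → innerSum≃0 k F λ j 2≤j j<k →
    pairCount≡0 F j (1+k*degree≤k+size⇒∣∩∣≢ uniform regular intersecting
                       (k[n-k]≡[m-1][k²-n]⇒1+k*d≤k+m 0<n equal) 2≤j j<k)
  where
  open SizeBound {k} {n} {length F} {d}
    (size*k≡n*degree uniform regular)
    (k+size≤1+k*degree uniform regular intersecting (here refl))
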